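{- For $J\in\binom{[n]}{k}$, the rational function $u_J$ on $\mathrm{Gr}(k,n)$ is invariant under the torus action, and hence is well defined on the configuration space $X(k,n)$, if and only if $J$ is not a cyclic interval.
   Context: Fix $2\le k<n$, with indices mod $n$. A cyclic interval is a set $\{a,a+1,\dots,a+m-1\}$ (mod $n$). $p_I$ denotes the Plücker coordinates on $\mathrm{Gr}(k,n)$. Torus action. The torus $(\mathbb{C}^*)^n$ acts by $(z_1,\dots,z_n)\cdot p_I=(\prod_{i\in I}z_i)p_I$. $X(k,n)$ is the quotient by this torus of the locus where all Plücker coordinates are nonzero. A rational function descends to $X(k,n)$ iff it is torus-invariant. Planar cross-ratio. For $J\in\binom{[n]}{k}$, let $I_J=\{j\in J: j+1\notin J\}$ and $e_J=\sum_{j\in J}e_j\in\mathbb{R}^n$. The cubical array $C_J$ is the set of $k$-subsets $M$ with $e_M=e_J+\sum_{m\in A}(e_{m+1}-e_m)$ for some $A\subseteq I_J$. Define $$u_J=\prod_{M\in C_J}p_M^{(-1)^{|J\cap M|-k-1}}.$$ -}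

module Defs where

open import Data.Nat as ℕ using (ℕ; zero; suc; _<_)
open import Data.Nat.DivMod using (_mod_; _%_)
open import Data.Integer as ℤ using (ℤ; +_; -_; 0ℤ; 1ℤ)
open import Data.Fin as Fin using (Fin; toℕ)
open import Data.Fin.Subset using (Subset; _∈_; _∩_; ∣_∣)
open import Data.Bool using (Bool; true; false; _∧_; not; if_then_else_)
open import Data.Vec using (Vec; []; _∷_; lookup; tabulate)
open import Data.List as List using (List; []; _∷_; allFin; foldr)
open import Data.Bool.ListAction using (any; all)
open import Data.Product using (∃; _×_)
open import Function using (_∘_)
open import Relation.Nullary using (Dec; does)
open import Relation.Binary.PropositionalEquality using (_≡_)

sucMod : ∀ {n} → Fin n → Fin n
sucMod {suc m} i = suc (toℕ i) mod suc m

_+mod_ : ∀ {n} → Fin n → ℕ → Fin n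
a +mod zero  = a
a +mod suc t = sucMod (a +mod t)

IsCyclicInterval : ∀ {n} → Subset n → Set
IsCyclicInterval {n} J =
  ∃ λ (a : Fin n) → ∃ λ (m : ℕ) →
    ∀ (i : Fin n) → (i ∈ J → ∃ λ t → t < m × i ≡ a +mod t)
                  × ((∃ λ t → t < m × i ≡ a +mod t) → i ∈ J)

Σℤ : ∀ {A : Set} → List A → (A → ℤ) → ℤ
Σℤ xs f = foldr (λ x s → f x ℤ.+ s) 0ℤ xs

subsets : ∀ n → List (Subset n)
subsets zero    = [] ∷ []
subsets (suc n) = List.map (true ∷_) (subsets n) List.++ List.map (false ∷_) (subsets n)

ind : Bool → ℤ
ind true  = 1ℤ
ind false = 0ℤ

e : ∀ {n} → Subset n → Fin n → ℤ
e J i = ind (lookup J i)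

I : ∀ {n} → Subset n → Subset n
I J = tabulate λ j → lookup J j ∧ not (lookup J (sucMod j))

shiftVec : ∀ {n} → Subset n → Fin n → ℤ
shiftVec {n} A i =
  Σℤ (allFin n) λ m → ind (lookup A m) ℤ.* (ind (does (sucMod m Fin.≟ i)) ℤ.- ind (does (m Fin.≟ i)))

vecEq : ∀ {n} → (Fin n → ℤ) → (Fin n → ℤ) → Bool
vecEq {n} v w = all (λ i → does (v i ℤ.≟ w i)) (allFin n)

subsetB : ∀ {n} → Subset n → Subset n → Bool
subsetB {n} A B = all (λ i → not (lookup A i) Data.Bool.∨ lookup B i) (allFin n)
  where import Data.Bool

inC : ∀ {n} → ℕ → Subset n → Subset n → Bool
inC {n} k J M =
  does (∣ M ∣ ℕ.≟ k) ∧
  any (λ A → subsetB A (I J) ∧ vecEq (e M) (λ i → e J i ℤ.+ shiftVec A i)) (subsets n)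

-- the exponent (-1)^{|J ∩ M| - k - 1}  (only its parity matters)
expo : ∀ {n} → ℕ → Subset n → Subset n → ℤ
expo k J M = if does ((∣ J ∩ M ∣ ℕ.+ k ℕ.+ 1) % 2 ℕ.≟ 0) then 1ℤ else - 1ℤ

-- u_J = ∏_{M ∈ C_J} p_M^{expo(M)} as a Laurent monomial in the Plücker
-- coordinates: exponent of p_M (zero if M ∉ C_J)
uExp : ∀ {n} → ℕ → Subset n → Subset n → ℤ
uExp k J M = if inC k J M then expo k J M else 0ℤ

-- Torus weight of the Laurent monomial ∏_M p_M^{a_M}: under
-- (z_1..z_n)·p_M = (∏_{i∈M} z_i) p_M it is scaled by ∏_i z_i^{w_i} with
-- w_i = Σ_{M ∋ i} a_M.
torusWeight : ∀ {n} → (Subset n → ℤ) → Fin n → ℤ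
torusWeight {n} a i = Σℤ (subsets n) λ M → a M ℤ.* e M i

-- invariance under (C^*)^n: the character ∏ z_i^{w_i} is trivial, i.e. w = 0
TorusInvariant : ∀ {n} → (Subset n → ℤ) → Set
TorusInvariant {n} a = ∀ (i : Fin n) → torusWeight a i ≡ 0ℤ

{-# OPTIONS --safe #-}
module Submission where

-- The torus weight of u_J at i is Σ_{M ∈ C_J} ±[i ∈ M]. For an element m of I_J, toggling
-- both m and m+1 maps the vertex of C_J indexed by A to the one indexed by A △ {m}; it changes
-- |J ∩ M| by one, so it reverses signs, and it fixes every other coordinate. Hence the weight
-- vanishes outside {m, m+1}. If J is not a cyclic interval, I_J has two elements whose pairs
-- {m, m+1} are disjoint, and every weight vanishes. If J is a cyclic interval with last
-- element b, then I_J ⊆ {b} and J is the only vertex of C_J containing b, so the weight at b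
-- is the sign of J itself, which is -1.

open import Defs
open import Data.Nat using (ℕ; _≤_; _<_)
open import Data.Fin.Subset using (Subset; ∣_∣)
open import Relation.Binary.PropositionalEquality using (_≡_)
open import Relation.Nullary using (¬_)
open import Data.Product using (_×_)

open import Data.Bool as Bool using (Bool; true; false; not; _∧_; _∨_; T; T?; if_then_else_)
open import Data.Bool.ListAction using (all; any)
open import Data.Bool.Properties using (not-involutive; T-≡; T-∧; T-not-≡)
open import Data.Empty using (⊥-elim)
open import Data.Fin as Fin using (Fin; zero; suc; toℕ)
import Data.Fin.Properties as Finₚ
open import Data.Fin.Subset using (_∈_; _∩_; Nonempty)
open import Data.Fin.Subset.Properties using (∩-idem; nonempty?; Empty-unique; ∣⊥∣≡0)
open import Data.Integer as ℤ using (ℤ; -[1+_]; 0ℤ; 1ℤ; -_; _+_; _*_)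
import Data.Integer.Properties as ℤₚ
open import Data.List as List using (List; []; _∷_; allFin)
open import Data.List.Relation.Unary.All using (All; []; _∷_; universal)
import Data.List.Relation.Unary.All.Properties as Allₚ
import Data.List.Relation.Unary.Any as Any
import Data.List.Relation.Unary.Any.Properties as Anyₚ
import Data.List.Membership.Propositional as List
import Data.List.Membership.Propositional.Properties as Listₚ
open import Data.Nat as ℕ using (zero; suc; z≤n; s≤s; z<s; _∸_; NonZero)
import Data.Nat.Properties as ℕₚ
open import Data.Nat.Divisibility using (∣-refl)
open import Data.Nat.DivMod
open import Data.Product using (∃; ∃₂; _,_; proj₁; proj₂)
open import Data.Product.Function.NonDependent.Propositional using (_×-⇔_)
open import Data.Sum using (_⊎_; inj₁; inj₂)
open import Data.Vec as Vec using ([]; _∷_; lookup; updateAt)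
import Data.Vec.Properties as Vecₚ
open import Function using (_∘_; id; _⇔_; mk⇔; Equivalence)
open import Function.Properties.Equivalence using () renaming (trans to ⇔-trans)
open import Relation.Binary.PropositionalEquality
  using (refl; sym; trans; cong; cong₂; subst; _≢_; ≢-sym; module ≡-Reasoning)
open import Relation.Nullary using (Dec; yes; no; does; contradiction)
open import Relation.Nullary.Decidable using (dec-true; dec-false; decidable-stable; _×-dec_; ¬?)
open import Relation.Unary using (Decidable)

open Equivalence using (to; from)

module _ {A : Set} where

  Σℤ-cong : (xs : List A) {f g : A → ℤ} → (∀ x → f x ≡ g x) → Σℤ xs f ≡ Σℤ xs g
  Σℤ-cong []       f≗g = refl
  Σℤ-cong (x ∷ xs) f≗g = cong₂ _+_ (f≗g x) (Σℤ-cong xs f≗g)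

  Σℤ-zero : {xs : List A} {f : A → ℤ} → All (λ x → f x ≡ 0ℤ) xs → Σℤ xs f ≡ 0ℤ
  Σℤ-zero []            = refl
  Σℤ-zero (fx≡0 ∷ f≡0) = cong₂ _+_ fx≡0 (Σℤ-zero f≡0)

  Σℤ-neg : (xs : List A) (f : A → ℤ) → Σℤ xs (-_ ∘ f) ≡ - Σℤ xs f
  Σℤ-neg []       f = refl
  Σℤ-neg (x ∷ xs) f = trans (cong ((- f x) +_) (Σℤ-neg xs f)) (sym (ℤₚ.neg-distrib-+ (f x) _))

  Σℤ-++ : (xs ys : List A) (f : A → ℤ) → Σℤ (xs List.++ ys) f ≡ Σℤ xs f + Σℤ ys f
  Σℤ-++ []       ys f = sym (ℤₚ.+-identityˡ _)
  Σℤ-++ (x ∷ xs) ys f = trans (cong (f x +_) (Σℤ-++ xs ys f)) (sym (ℤₚ.+-assoc (f x) _ _))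

  Σℤ-map : {B : Set} (h : B → A) (xs : List B) (f : A → ℤ) → Σℤ (List.map h xs) f ≡ Σℤ xs (f ∘ h)
  Σℤ-map h []       f = refl
  Σℤ-map h (x ∷ xs) f = cong (f (h x) +_) (Σℤ-map h xs f)

  Σℤ-tabulate-single : ∀ {n} (g : Fin n → A) {f : A → ℤ} (j : Fin n) →
                       (∀ i → i ≢ j → f (g i) ≡ 0ℤ) → Σℤ (List.tabulate g) f ≡ f (g j)
  Σℤ-tabulate-single g {f} zero    off-j =
    trans (cong (f (g zero) +_) (Σℤ-zero {xs = List.tabulate (g ∘ suc)} {f}
                                  (Allₚ.tabulate⁺ λ i → off-j (suc i) λ ())))
          (ℤₚ.+-identityʳ _)
  Σℤ-tabulate-single g {f} (suc j) off-j =
    trans (cong₂ _+_ (off-j zero λ ())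
                     (Σℤ-tabulate-single (g ∘ suc) {f} j λ i i≢j →
                       off-j (suc i) (i≢j ∘ Finₚ.suc-injective)))
          (ℤₚ.+-identityˡ _)

Σℤ-allFin-single : ∀ {n} {f : Fin n → ℤ} (j : Fin n) →
                   (∀ i → i ≢ j → f i ≡ 0ℤ) → Σℤ (allFin n) f ≡ f j
Σℤ-allFin-single = Σℤ-tabulate-single id

i≡-i⇒i≡0 : ∀ {i} → i ≡ - i → i ≡ 0ℤ
i≡-i⇒i≡0 {ℤ.+ zero}   _  = refl
i≡-i⇒i≡0 {ℤ.+ suc _}  ()
i≡-i⇒i≡0 { -[1+ _ ]} ()

toggle : ∀ {n} → Fin n → Subset n → Subset n
toggle j M = updateAt M j not

lookup-toggle-same : ∀ {n} (j : Fin n) M → lookup (toggle j M) j ≡ not (lookup M j)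
lookup-toggle-same j M = Vecₚ.lookup∘updateAt j M

lookup-toggle-other : ∀ {n} {i j : Fin n} M → i ≢ j → lookup (toggle j M) i ≡ lookup M i
lookup-toggle-other M i≢j = Vecₚ.lookup∘updateAt′ _ _ i≢j M

toggle-involutive : ∀ {n} (j : Fin n) M → toggle j (toggle j M) ≡ M
toggle-involutive j M =
  trans (Vecₚ.updateAt-updateAt-local j M (not-involutive _)) (Vecₚ.updateAt-id j M)

lookup-ext : ∀ {n} {X Y : Subset n} → (∀ i → lookup X i ≡ lookup Y i) → X ≡ Y
lookup-ext {X = X} {Y} X≗Y =
  trans (sym (Vecₚ.tabulate∘lookup X)) (trans (Vecₚ.tabulate-cong X≗Y) (Vecₚ.tabulate∘lookup Y))

lookup-∩ : ∀ {n} (X Y : Subset n) i → lookup (X ∩ Y) i ≡ lookup X i ∧ lookup Y i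
lookup-∩ X Y i = Vecₚ.lookup-zipWith _∧_ i X Y

∈≢∉ : ∀ {n} (J : Subset n) {x y} → lookup J x ≡ true → lookup J y ≡ false → x ≢ y
∈≢∉ J x∈J y∉J refl with () ← trans (sym x∈J) y∉J

∣∣-toggle-inside : ∀ {n} (j : Fin n) M → lookup M j ≡ true → ∣ M ∣ ≡ suc ∣ toggle j M ∣
∣∣-toggle-inside zero    (true ∷ M)  refl = refl
∣∣-toggle-inside (suc j) (true ∷ M)  Mj   = cong suc (∣∣-toggle-inside j M Mj)
∣∣-toggle-inside (suc j) (false ∷ M) Mj   = ∣∣-toggle-inside j M Mj

∣∣-toggle-outside : ∀ {n} (j : Fin n) M → lookup M j ≡ false → ∣ toggle j M ∣ ≡ suc ∣ M ∣
∣∣-toggle-outside j M Mj =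
  trans (∣∣-toggle-inside j (toggle j M) (trans (lookup-toggle-same j M) (cong not Mj)))
        (cong (suc ∘ ∣_∣) (toggle-involutive j M))

∈-subsets : ∀ {n} (M : Subset n) → M List.∈ subsets n
∈-subsets []          = Any.here refl
∈-subsets (true ∷ M)  = Listₚ.∈-++⁺ˡ (Listₚ.∈-map⁺ (true ∷_) (∈-subsets M))
∈-subsets (false ∷ M) = Listₚ.∈-++⁺ʳ _ (Listₚ.∈-map⁺ (false ∷_) (∈-subsets M))

Σℤ-subsets-suc : ∀ n (f : Subset (suc n) → ℤ) →
  Σℤ (subsets (suc n)) f ≡ Σℤ (subsets n) (f ∘ (true ∷_)) + Σℤ (subsets n) (f ∘ (false ∷_))
Σℤ-subsets-suc n f =
  trans (Σℤ-++ (List.map (true ∷_) (subsets n)) _ f)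
        (cong₂ _+_ (Σℤ-map (true ∷_) (subsets n) f) (Σℤ-map (false ∷_) (subsets n) f))

Σℤ-subsets-toggle : ∀ {n} (j : Fin n) (f : Subset n → ℤ) →
                    Σℤ (subsets n) f ≡ Σℤ (subsets n) (f ∘ toggle j)
Σℤ-subsets-toggle {suc n} zero    f =
  trans (Σℤ-subsets-suc n f)
        (trans (ℤₚ.+-comm (Σℤ (subsets n) (f ∘ (true ∷_))) _) (sym (Σℤ-subsets-suc n (f ∘ toggle zero))))
Σℤ-subsets-toggle {suc n} (suc j) f =
  trans (Σℤ-subsets-suc n f)
        (trans (cong₂ _+_ (Σℤ-subsets-toggle j (f ∘ (true ∷_)))
                          (Σℤ-subsets-toggle j (f ∘ (false ∷_))))
               (sym (Σℤ-subsets-suc n (f ∘ toggle (suc j)))))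

Σℤ-subsets-single : ∀ {n} (X : Subset n) {f : Subset n → ℤ} →
                    (∀ M → M ≢ X → f M ≡ 0ℤ) → Σℤ (subsets n) f ≡ f X
Σℤ-subsets-single          []          {f} off-X = ℤₚ.+-identityʳ _
Σℤ-subsets-single {suc n} (true ∷ X)  {f} off-X =
  trans (Σℤ-subsets-suc n f)
        (trans (cong₂ _+_ (Σℤ-subsets-single X λ M M≢X → off-X (true ∷ M) (M≢X ∘ Vecₚ.∷-injectiveʳ))
                          (Σℤ-zero (universal (λ M → off-X (false ∷ M) λ ()) (subsets n))))
               (ℤₚ.+-identityʳ _))
Σℤ-subsets-single {suc n} (false ∷ X) {f} off-X =
  trans (Σℤ-subsets-suc n f)
        (trans (cong₂ _+_ (Σℤ-zero (universal (λ M → off-X (true ∷ M) λ ()) (subsets n)))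
                          (Σℤ-subsets-single X λ M M≢X → off-X (false ∷ M) (M≢X ∘ Vecₚ.∷-injectiveʳ)))
               (ℤₚ.+-identityˡ _))

sign : ℕ → ℤ
sign x = if does (x % 2 ℕ.≟ 0) then 1ℤ else - 1ℤ

sign-+2 : ∀ x → sign (2 ℕ.+ x) ≡ sign x
sign-+2 x = cong (λ r → if does (r ℕ.≟ 0) then 1ℤ else - 1ℤ)
                 (trans (cong (_% 2) (ℕₚ.+-comm 2 x)) ([m+n]%n≡m%n x 2))

sign-suc : ∀ x → sign (suc x) ≡ - sign x
sign-suc zero          = refl
sign-suc (suc zero)    = refl
sign-suc (suc (suc x)) = trans (sign-+2 (suc x)) (trans (sign-suc x) (cong -_ (sym (sign-+2 x))))

sign-double : ∀ x → sign (x ℕ.+ x) ≡ 1ℤ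
sign-double zero    = refl
sign-double (suc x) =
  trans (cong (sign ∘ suc) (ℕₚ.+-suc x x)) (trans (sign-+2 (x ℕ.+ x)) (sign-double x))

sign-double+1 : ∀ x → sign (x ℕ.+ x ℕ.+ 1) ≡ - 1ℤ
sign-double+1 x =
  trans (cong sign (ℕₚ.+-comm (x ℕ.+ x) 1)) (trans (sign-suc (x ℕ.+ x)) (cong -_ (sign-double x)))

expo-suc : ∀ {n} k (J M M′ : Subset n) → ∣ J ∩ M ∣ ≡ suc ∣ J ∩ M′ ∣ → expo k J M ≡ - expo k J M′
expo-suc k J M M′ eq =
  trans (cong (λ c → sign (c ℕ.+ k ℕ.+ 1)) eq) (sign-suc (∣ J ∩ M′ ∣ ℕ.+ k ℕ.+ 1))

-- Cyclic shifts modulo n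

toℕ-sucMod : ∀ {m} (x : Fin (suc m)) → toℕ (sucMod x) ≡ suc (toℕ x) % suc m
toℕ-sucMod {m} x = Finₚ.toℕ-fromℕ< (m%n<n (suc (toℕ x)) (suc m))

sucMod-cases : ∀ {m} (x : Fin (suc m)) →
               (toℕ x ≡ m × toℕ (sucMod x) ≡ 0) ⊎ toℕ (sucMod x) ≡ suc (toℕ x)
sucMod-cases {m} x with ℕₚ.m≤n⇒m<n∨m≡n (ℕ.s≤s⁻¹ (Finₚ.toℕ<n x))
... | inj₁ x<m  = inj₂ (trans (toℕ-sucMod x) (m≤n⇒m%n≡m x<m))
... | inj₂ x≡m  =
  inj₁ (x≡m , trans (toℕ-sucMod x) (trans (cong (λ r → suc r % suc m) x≡m) (n%n≡0 (suc m))))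

sucMod-injective : ∀ {n} {x y : Fin n} → sucMod x ≡ sucMod y → x ≡ y
sucMod-injective {suc m} {x} {y} eq with sucMod-cases x | sucMod-cases y
... | inj₁ (x≡m , _)  | inj₁ (y≡m , _)  = Finₚ.toℕ-injective (trans x≡m (sym y≡m))
... | inj₁ (_ , sx≡0) | inj₂ sy≡       with () ← trans (sym sx≡0) (trans (cong toℕ eq) sy≡)
... | inj₂ sx≡        | inj₁ (_ , sy≡0) with () ← trans (sym sy≡0) (trans (cong toℕ (sym eq)) sx≡)
... | inj₂ sx≡        | inj₂ sy≡       =
  Finₚ.toℕ-injective (ℕₚ.suc-injective (trans (sym sx≡) (trans (cong toℕ eq) sy≡)))

[m+n%d]%d≡[m+n]%d : ∀ m n d .{{_ : NonZero d}} → (m ℕ.+ n % d) % d ≡ (m ℕ.+ n) % d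
[m+n%d]%d≡[m+n]%d m n d = begin
  (m ℕ.+ n % d) % d             ≡⟨ %-distribˡ-+ m (n % d) d ⟩
  (m % d ℕ.+ n % d % d) % d     ≡⟨ cong (λ r → (m % d ℕ.+ r) % d) (m%n%n≡m%n n d) ⟩
  (m % d ℕ.+ n % d) % d         ≡⟨ %-distribˡ-+ m n d ⟨
  (m ℕ.+ n) % d                 ∎
  where open ≡-Reasoning

toℕ-+mod : ∀ {m} (a : Fin (suc m)) t → toℕ (a +mod t) ≡ (toℕ a ℕ.+ t) % suc m
toℕ-+mod {m} a zero    =
  sym (trans (cong (_% suc m) (ℕₚ.+-identityʳ (toℕ a))) (m<n⇒m%n≡m (Finₚ.toℕ<n a)))
toℕ-+mod {m} a (suc t) = begin
  toℕ (sucMod (a +mod t))                  ≡⟨ toℕ-sucMod (a +mod t) ⟩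
  (1 ℕ.+ toℕ (a +mod t)) % suc m           ≡⟨ cong (λ r → (1 ℕ.+ r) % suc m) (toℕ-+mod a t) ⟩
  (1 ℕ.+ (toℕ a ℕ.+ t) % suc m) % suc m    ≡⟨ [m+n%d]%d≡[m+n]%d 1 (toℕ a ℕ.+ t) (suc m) ⟩
  (1 ℕ.+ (toℕ a ℕ.+ t)) % suc m            ≡⟨ cong (_% suc m) (ℕₚ.+-suc (toℕ a) t) ⟨
  (toℕ a ℕ.+ suc t) % suc m                ∎
  where open ≡-Reasoning

+mod-+ : ∀ {n} (a : Fin n) p q → (a +mod p) +mod q ≡ a +mod (p ℕ.+ q)
+mod-+ a p zero    = cong (a +mod_) (sym (ℕₚ.+-identityʳ p))
+mod-+ a p (suc q) = trans (cong sucMod (+mod-+ a p q)) (cong (a +mod_) (sym (ℕₚ.+-suc p q)))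

+mod-onto : ∀ {m} (c i : Fin (suc m)) → ∃ λ t → t < suc m × i ≡ c +mod t
+mod-onto {m} c i = t , m%n<n (n ∸ toℕ c ℕ.+ toℕ i) n , sym (Finₚ.toℕ-injective toℕ[c+t]≡i)
  where
  n t : ℕ
  n = suc m
  t = (n ∸ toℕ c ℕ.+ toℕ i) % n
  toℕ[c+t]≡i : toℕ (c +mod t) ≡ toℕ i
  toℕ[c+t]≡i = begin
    toℕ (c +mod t)                        ≡⟨ toℕ-+mod c t ⟩
    (toℕ c ℕ.+ t) % n                     ≡⟨ [m+n%d]%d≡[m+n]%d (toℕ c) _ n ⟩
    (toℕ c ℕ.+ (n ∸ toℕ c ℕ.+ toℕ i)) % n  ≡⟨ cong (_% n) (ℕₚ.+-assoc (toℕ c) _ (toℕ i)) ⟨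
    (toℕ c ℕ.+ (n ∸ toℕ c) ℕ.+ toℕ i) % n  ≡⟨ cong (λ r → (r ℕ.+ toℕ i) % n) c+[n∸c]≡n ⟩
    (n ℕ.+ toℕ i) % n                     ≡⟨ %-remove-+ˡ (toℕ i) ∣-refl ⟩
    toℕ i % n                             ≡⟨ m<n⇒m%n≡m (Finₚ.toℕ<n i) ⟩
    toℕ i                                 ∎
    where
    open ≡-Reasoning
    c+[n∸c]≡n : toℕ c ℕ.+ (n ∸ toℕ c) ≡ n
    c+[n∸c]≡n = ℕₚ.m+[n∸m]≡n (ℕₚ.<⇒≤ (Finₚ.toℕ<n c))

+mod-no-return : ∀ {m} (a : Fin (suc m)) {t} → 0 < t → t < suc m → a +mod t ≢ a
+mod-no-return {m} a {t} 0<t t<n eq = no-multiple q t≡q*n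
  where
  q : ℕ
  q = (toℕ a ℕ.+ t) / suc m
  t≡q*n : t ≡ q ℕ.* suc m
  t≡q*n = ℕₚ.+-cancelˡ-≡ (toℕ a) _ _ (begin
    toℕ a ℕ.+ t                          ≡⟨ m≡m%n+[m/n]*n (toℕ a ℕ.+ t) (suc m) ⟩
    (toℕ a ℕ.+ t) % suc m ℕ.+ q ℕ.* suc m  ≡⟨ cong (ℕ._+ q ℕ.* suc m) r≡a ⟩
    toℕ a ℕ.+ q ℕ.* suc m                ∎)
    where
    open ≡-Reasoning
    r≡a : (toℕ a ℕ.+ t) % suc m ≡ toℕ a
    r≡a = trans (sym (toℕ-+mod a t)) (cong toℕ eq)
  no-multiple : ∀ q → t ≢ q ℕ.* suc m
  no-multiple zero    refl = ℕₚ.<-irrefl refl 0<t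
  no-multiple (suc q) refl = ℕₚ.<-irrefl refl (ℕₚ.<-≤-trans t<n (ℕₚ.m≤m+n (suc m) _))

-- Cyclic intervals

-- Membership in I_J; its elements, the last elements of the runs of J, are called ends below.
_∈I_ : ∀ {n} → Fin n → Subset n → Set
x ∈I J = lookup J x ≡ true × lookup J (sucMod x) ≡ false

∈I? : ∀ {n} (J : Subset n) → Decidable (_∈I J)
∈I? J x = (lookup J x Bool.≟ true) ×-dec (lookup J (sucMod x) Bool.≟ false)

∈I⇒≢sucMod : ∀ {n} (J : Subset n) {x} → x ∈I J → x ≢ sucMod x
∈I⇒≢sucMod J (x∈J , sx∉J) = ∈≢∉ J x∈J sx∉J

cyclic⇒unique-end : ∀ {n} {J : Subset n} {j} → IsCyclicInterval J → j ∈ J →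
                    ∃ λ b → lookup J b ≡ true × (∀ x → x ∈I J → x ≡ b)
cyclic⇒unique-end {j = j} (a , zero , J≡interval) j∈J
  with () ← proj₁ (proj₂ (proj₁ (J≡interval j) j∈J))
cyclic⇒unique-end {J = J} (a , suc m , J≡interval) _ =
  a +mod m , Vecₚ.[]=⇒lookup (proj₂ (J≡interval (a +mod m)) (m , ℕₚ.≤-refl , refl)) , only-end
  where
  only-end : ∀ x → x ∈I J → x ≡ a +mod m
  only-end x (x∈J , sx∉J) with proj₁ (J≡interval x) (Vecₚ.lookup⇒[]= x J x∈J)
  ... | t , t≤m , x≡a+t with ℕₚ.m≤n⇒m<n∨m≡n (ℕ.s≤s⁻¹ t≤m)
  ...   | inj₂ refl = x≡a+t
  ...   | inj₁ t<m  = ⊥-elim (∈≢∉ J (Vecₚ.[]=⇒lookup sx∈J) sx∉J refl)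
    where
    sx∈J : sucMod x ∈ J
    sx∈J = proj₂ (J≡interval (sucMod x)) (suc t , s≤s t<m , cong sucMod x≡a+t)

monotone⇒upset : ∀ {P : ℕ → Set} → Decidable P → ∀ n → (∀ t → suc t < n → P t → P (suc t)) →
                 ∃ λ t₀ → t₀ ≤ n × (∀ t → t < n → P t → t₀ ≤ t) × (∀ t → t₀ ≤ t → t < n → P t)
monotone⇒upset P? zero    step = 0 , z≤n , (λ _ ()) , (λ _ _ ())
monotone⇒upset {P} P? (suc n) step with monotone⇒upset (P? ∘ suc) n (λ t → step (suc t) ∘ s≤s) | P? 0
... | t₀ , t₀≤n , sound , complete | no ¬P0 = suc t₀ , s≤s t₀≤n , sound′ , complete′
  where
  sound′ : ∀ t → t < suc n → P t → suc t₀ ≤ t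
  sound′ zero    _         P0 = contradiction P0 ¬P0
  sound′ (suc t) (s≤s t<n) Pt = s≤s (sound t t<n Pt)
  complete′ : ∀ t → suc t₀ ≤ t → t < suc n → P t
  complete′ (suc t) (s≤s t₀≤t) (s≤s t<n) = complete t t₀≤t t<n
... | t₀ , t₀≤n , sound , complete | yes P0 = 0 , z≤n , (λ _ _ _ → z≤n) , complete′
  where
  complete′ : ∀ t → 0 ≤ t → t < suc n → P t
  complete′ zero    _ _         = P0
  complete′ (suc t) _ (s≤s t<n) = complete t (ℕₚ.≤-trans t₀≤0 z≤n) t<n
    where
    0<n : 0 < n
    0<n = ℕₚ.≤-trans (s≤s z≤n) t<n
    t₀≤0 : t₀ ≤ 0
    t₀≤0 = sound 0 0<n (step 0 (s≤s 0<n) P0)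

run-continues : ∀ {m} (J : Subset (suc m)) (b : Fin (suc m)) → (∀ x → x ∈I J → x ≡ b) →
                ∀ t → suc t < suc m →
                lookup J (sucMod b +mod t) ≡ true → lookup J (sucMod b +mod suc t) ≡ true
run-continues J b only-b t 1+t<n b+1+t∈J with lookup J (sucMod (sucMod b +mod t)) in b+2+t∈J
... | true  = refl
... | false = contradiction (trans (sym (+mod-+ b 1 t)) (only-b _ (b+1+t∈J , b+2+t∈J)))
                            (+mod-no-return b (s≤s z≤n) 1+t<n)

-- J meets the walk b+1, b+2, …, b+n = b in a final segment, which is the cyclic interval.
at-most-one-end⇒cyclic : ∀ {m} (J : Subset (suc m)) (b : Fin (suc m)) →
                         (∀ x → x ∈I J → x ≡ b) → IsCyclicInterval J
at-most-one-end⇒cyclic {m} J b only-b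
  with monotone⇒upset (λ t → lookup J (sucMod b +mod t) Bool.≟ true) (suc m) (run-continues J b only-b)
... | t₀ , t₀≤n , sound , complete = sucMod b +mod t₀ , suc m ∸ t₀ , λ i → ⊆interval i , interval⊆ i
  where
  ⊆interval : ∀ i → i ∈ J → ∃ λ u → u < suc m ∸ t₀ × i ≡ (sucMod b +mod t₀) +mod u
  ⊆interval i i∈J with +mod-onto (sucMod b) i
  ... | t , t<n , i≡b+1+t = t ∸ t₀ , ℕₚ.∸-monoˡ-< t<n t₀≤t , (begin
    i                                  ≡⟨ i≡b+1+t ⟩
    sucMod b +mod t                    ≡⟨ cong (sucMod b +mod_) (ℕₚ.m+[n∸m]≡n t₀≤t) ⟨
    sucMod b +mod (t₀ ℕ.+ (t ∸ t₀))    ≡⟨ +mod-+ (sucMod b) t₀ (t ∸ t₀) ⟨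
    (sucMod b +mod t₀) +mod (t ∸ t₀)   ∎)
    where
    open ≡-Reasoning
    t₀≤t : t₀ ≤ t
    t₀≤t = sound t t<n (subst (λ x → lookup J x ≡ true) i≡b+1+t (Vecₚ.[]=⇒lookup i∈J))
  interval⊆ : ∀ i → (∃ λ u → u < suc m ∸ t₀ × i ≡ (sucMod b +mod t₀) +mod u) → i ∈ J
  interval⊆ i (u , u<len , i≡a+u) = Vecₚ.lookup⇒[]= i J
    (subst (λ x → lookup J x ≡ true) (sym (trans i≡a+u (+mod-+ (sucMod b) t₀ u)))
      (complete (t₀ ℕ.+ u) (ℕₚ.m≤m+n t₀ u)
        (subst (t₀ ℕ.+ u <_) (ℕₚ.m+[n∸m]≡n t₀≤n) (ℕₚ.+-monoʳ-< t₀ u<len))))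

¬cyclic⇒two-ends : ∀ {m} (J : Subset (suc m)) → ¬ IsCyclicInterval J →
                   ∃₂ λ m₁ m₂ → m₁ ∈I J × m₂ ∈I J × m₁ ≢ m₂
¬cyclic⇒two-ends J ¬cyclic = decidable-stable two-ends? λ ¬two → ¬cyclic (cyclic ¬two)
  where
  two-ends? : Dec (∃₂ λ m₁ m₂ → m₁ ∈I J × m₂ ∈I J × m₁ ≢ m₂)
  two-ends? = Finₚ.any? λ m₁ → Finₚ.any? λ m₂ → ∈I? J m₁ ×-dec ∈I? J m₂ ×-dec ¬? (m₁ Fin.≟ m₂)
  cyclic : ¬ (∃₂ λ m₁ m₂ → m₁ ∈I J × m₂ ∈I J × m₁ ≢ m₂) → IsCyclicInterval J
  cyclic ¬two with Finₚ.any? (∈I? J)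
  ... | yes (b , b∈I) = at-most-one-end⇒cyclic J b λ x x∈I →
          decidable-stable (x Fin.≟ b) λ x≢b → ¬two (x , b , x∈I , b∈I , x≢b)
  ... | no ¬end = at-most-one-end⇒cyclic J zero λ x x∈I → ⊥-elim (¬end (x , x∈I))

-- The cube C_J

_⊆I_ : ∀ {n} → Subset n → Subset n → Set
A ⊆I J = ∀ x → lookup A x ≡ true → x ∈I J

record CubeVertex {n} (J A M : Subset n) : Set where
  constructor vertex
  field
    ends   : A ⊆I J
    coords : ∀ i → e M i ≡ e J i + shiftVec A i

T-does : ∀ {P : Set} (P? : Dec P) → T (does P?) ⇔ P
T-does (yes p)  = mk⇔ (λ _ → p) _
T-does (no ¬p) = mk⇔ (λ ()) ¬p

T-all-allFin : ∀ {n} (p : Fin n → Bool) → T (all p (allFin n)) ⇔ (∀ i → T (p i))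
T-all-allFin p = mk⇔ (Allₚ.tabulate⁻ ∘ Allₚ.all⁺ p _) (Allₚ.all⁻ p ∘ Allₚ.tabulate⁺)

T-any-subsets : ∀ {n} (p : Subset n → Bool) → T (any p (subsets n)) ⇔ ∃ (T ∘ p)
T-any-subsets {n} p =
  mk⇔ (Any.satisfied ∘ Anyₚ.any⁻ p (subsets n)) (λ (A , pA) → Anyₚ.any⁺ p (List.lose (∈-subsets A) pA))

T-I : ∀ {n} (J : Subset n) x → T (lookup (I J) x) ⇔ x ∈I J
T-I J x rewrite Vecₚ.lookup∘tabulate (λ j → lookup J j ∧ not (lookup J (sucMod j))) x =
  ⇔-trans T-∧ (T-≡ ×-⇔ T-not-≡)

T-subsetB-I : ∀ {n} (A J : Subset n) → T (subsetB A (I J)) ⇔ A ⊆I J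
T-subsetB-I A J = ⇔-trans (T-all-allFin _) (mk⇔ sound complete)
  where
  sound : (∀ x → T (not (lookup A x) ∨ lookup (I J) x)) → A ⊆I J
  sound A⊆I x Ax = to (T-I J x) (subst (λ a → T (not a ∨ lookup (I J) x)) Ax (A⊆I x))
  complete : A ⊆I J → ∀ x → T (not (lookup A x) ∨ lookup (I J) x)
  complete A⊆I x with lookup A x in Ax
  ... | true  = from (T-I J x) (A⊆I x Ax)
  ... | false = _

T-vecEq : ∀ {n} (v w : Fin n → ℤ) → T (vecEq v w) ⇔ (∀ i → v i ≡ w i)
T-vecEq v w = ⇔-trans (T-all-allFin _) (mk⇔ (λ h i → to (eq⇔ i) (h i)) (λ h i → from (eq⇔ i) (h i)))
  where
  eq⇔ : ∀ i → T (does (v i ℤ.≟ w i)) ⇔ (v i ≡ w i)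
  eq⇔ i = T-does (v i ℤ.≟ w i)

inC⇔ : ∀ {n} {k} {J M : Subset n} → T (inC k J M) ⇔ (∣ M ∣ ≡ k × ∃ λ A → CubeVertex J A M)
inC⇔ {k = k} {J} {M} = ⇔-trans T-∧ (T-does (∣ M ∣ ℕ.≟ k) ×-⇔ ⇔-trans (T-any-subsets _) (mk⇔
  (λ (A , A∈) → A , to (vertex⇔ {A}) A∈) (λ (A , v) → A , from (vertex⇔ {A}) v)))
  where
  vertex⇔ : ∀ {A} → T (subsetB A (I J) ∧ vecEq (e M) (λ i → e J i + shiftVec A i)) ⇔ CubeVertex J A M
  vertex⇔ {A} = ⇔-trans T-∧ (⇔-trans (T-subsetB-I A J ×-⇔ T-vecEq _ _)
                 (mk⇔ (λ (A⊆I , eM) → vertex A⊆I eM) (λ (vertex A⊆I eM) → A⊆I , eM)))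

uExp-inside : ∀ {n} k (J M : Subset n) → T (inC k J M) → uExp k J M ≡ expo k J M
uExp-inside k J M M∈C with inC k J M
... | true = refl

uExp-outside : ∀ {n} k (J M : Subset n) → ¬ T (inC k J M) → uExp k J M ≡ 0ℤ
uExp-outside k J M M∉C with inC k J M
... | true  = ⊥-elim (M∉C _)
... | false = refl

shiftTerm : ∀ {n} → Subset n → Fin n → Fin n → ℤ
shiftTerm A i x = ind (lookup A x) * (ind (does (sucMod x Fin.≟ i)) ℤ.- ind (does (x Fin.≟ i)))

shiftTerm-zero : ∀ {n} (A : Subset n) {i x} →
                 (lookup A x ≡ true → x ≢ i × sucMod x ≢ i) → shiftTerm A i x ≡ 0ℤ
shiftTerm-zero A {i} {x} far with lookup A x
... | false = refl
... | true rewrite dec-false (sucMod x Fin.≟ i) (proj₂ (far refl))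
                 | dec-false (x Fin.≟ i) (proj₁ (far refl)) = refl

shiftTerm-self : ∀ {n} (A : Subset n) {i} →
                 (lookup A i ≡ true → sucMod i ≢ i) → shiftTerm A i i ≡ - ind (lookup A i)
shiftTerm-self A {i} i≢ with lookup A i
... | false = refl
... | true rewrite dec-false (sucMod i Fin.≟ i) (i≢ refl) | dec-true (i Fin.≟ i) refl = refl

shiftTerm-pred : ∀ {n} (A : Subset n) {x} →
                 (lookup A x ≡ true → x ≢ sucMod x) → shiftTerm A (sucMod x) x ≡ ind (lookup A x)
shiftTerm-pred A {x} x≢ with lookup A x
... | false = refl
... | true rewrite dec-true (sucMod x Fin.≟ sucMod x) refl
                 | dec-false (x Fin.≟ sucMod x) (x≢ refl) = refl

shiftVec-empty : ∀ {n} (A : Subset n) → (∀ x → lookup A x ≡ false) → ∀ i → shiftVec A i ≡ 0ℤ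
shiftVec-empty A A≡∅ i = Σℤ-zero {f = shiftTerm A i} (Allₚ.tabulate⁺ λ x → cong (λ b → ind b * _) (A≡∅ x))

shiftVec-toggle : ∀ {n} (A : Subset n) {m i} → i ≢ m → i ≢ sucMod m →
                  shiftVec (toggle m A) i ≡ shiftVec A i
shiftVec-toggle {n} A {m} {i} i≢m i≢sm = Σℤ-cong (allFin n) term≡
  where
  term≡ : ∀ x → shiftTerm (toggle m A) i x ≡ shiftTerm A i x
  term≡ x with x Fin.≟ m
  ... | yes refl = trans (shiftTerm-zero (toggle m A) far) (sym (shiftTerm-zero A far))
    where
    far : ∀ {b} → b → x ≢ i × sucMod x ≢ i
    far _ = ≢-sym i≢m , ≢-sym i≢sm
  ... | no x≢m = cong (λ b → ind b * _) (lookup-toggle-other A x≢m)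

ind-not : ∀ b → 1ℤ + - ind b ≡ ind (not b)
ind-not true  = refl
ind-not false = refl

ind-injective : ∀ {b c} → ind b ≡ ind c → b ≡ c
ind-injective {true}  {true}  _ = refl
ind-injective {false} {false} _ = refl

module _ {n} {J A : Subset n} (A⊆I : A ⊆I J) where

  cube-∈ : ∀ {i} → lookup J i ≡ true → e J i + shiftVec A i ≡ ind (not (lookup A i))
  cube-∈ {i} i∈J = begin
    e J i + shiftVec A i              ≡⟨ cong₂ _+_ (cong ind i∈J) shiftVec≡ ⟩
    1ℤ + - ind (lookup A i)           ≡⟨ ind-not (lookup A i) ⟩
    ind (not (lookup A i))            ∎
    where
    open ≡-Reasoning
    shiftVec≡ : shiftVec A i ≡ - ind (lookup A i)
    shiftVec≡ = trans
      (Σℤ-allFin-single {f = shiftTerm A i} i λ x x≢i →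
        shiftTerm-zero A λ Ax → x≢i , ≢-sym (∈≢∉ J i∈J (proj₂ (A⊆I x Ax))))
      (shiftTerm-self A λ Ai → ≢-sym (∈I⇒≢sucMod J (A⊆I i Ai)))

  cube-suc : ∀ {m} → m ∈I J → e J (sucMod m) + shiftVec A (sucMod m) ≡ ind (lookup A m)
  cube-suc {m} m∈I@(_ , sm∉J) = begin
    e J (sucMod m) + shiftVec A (sucMod m)  ≡⟨ cong (λ b → ind b + shiftVec A (sucMod m)) sm∉J ⟩
    0ℤ + shiftVec A (sucMod m)              ≡⟨ ℤₚ.+-identityˡ _ ⟩
    shiftVec A (sucMod m)                   ≡⟨ shiftVec≡ ⟩
    ind (lookup A m)                        ∎
    where
    open ≡-Reasoning
    shiftVec≡ : shiftVec A (sucMod m) ≡ ind (lookup A m)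
    shiftVec≡ = trans
      (Σℤ-allFin-single {f = shiftTerm A (sucMod m)} m λ x x≢m →
        shiftTerm-zero A λ Ax → ∈≢∉ J (proj₁ (A⊆I x Ax)) sm∉J , x≢m ∘ sucMod-injective)
      (shiftTerm-pred A λ _ → ∈I⇒≢sucMod J m∈I)

module _ {n} {J A M : Subset n} (v : CubeVertex J A M) where

  open CubeVertex v

  vertex-∈ : ∀ {i} → lookup J i ≡ true → lookup M i ≡ not (lookup A i)
  vertex-∈ {i} i∈J = ind-injective (trans (coords i) (cube-∈ {J = J} {A} ends i∈J))

  vertex-suc : ∀ {m} → m ∈I J → lookup M (sucMod m) ≡ lookup A m
  vertex-suc {m} m∈I = ind-injective (trans (coords (sucMod m)) (cube-suc {J = J} {A} ends m∈I))

  vertex-empty : (∀ x → lookup A x ≡ false) → M ≡ J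
  vertex-empty A≡∅ = lookup-ext λ i →
    ind-injective (trans (coords i) (trans (cong (e J i +_) (shiftVec-empty A A≡∅ i)) (ℤₚ.+-identityʳ _)))

J∈C : ∀ {n} {k} (J : Subset n) → ∣ J ∣ ≡ k → T (inC k J J)
J∈C {n} {k} J ∣J∣≡k = from (inC⇔ {k = k} {J} {J}) (∣J∣≡k , ∅ , vertex ∅⊆I eJ)
  where
  ∅ : Subset n
  ∅ = Vec.replicate n false
  ∅≡∅ : ∀ x → lookup ∅ x ≡ false
  ∅≡∅ x = Vecₚ.lookup-replicate x false
  ∅⊆I : ∅ ⊆I J
  ∅⊆I x ∅x with () ← trans (sym ∅x) (∅≡∅ x)
  eJ : ∀ i → e J i ≡ e J i + shiftVec ∅ i
  eJ i = sym (trans (cong (e J i +_) (shiftVec-empty ∅ ∅≡∅ i)) (ℤₚ.+-identityʳ _))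

-- The sign-reversing involution

module Flip {n} (k : ℕ) (J : Subset n) {m : Fin n} (m∈I : m ∈I J) where

  s : Fin n
  s = sucMod m

  m∈J : lookup J m ≡ true
  m∈J = proj₁ m∈I

  s∉J : lookup J s ≡ false
  s∉J = proj₂ m∈I

  m≢s : m ≢ s
  m≢s = ∈I⇒≢sucMod J m∈I

  τ : Subset n → Subset n
  τ M = toggle m (toggle s M)

  lookup-τ-m : ∀ M → lookup (τ M) m ≡ not (lookup M m)
  lookup-τ-m M = trans (lookup-toggle-same m (toggle s M)) (cong not (lookup-toggle-other M m≢s))

  lookup-τ-s : ∀ M → lookup (τ M) s ≡ not (lookup M s)
  lookup-τ-s M = trans (lookup-toggle-other (toggle s M) (≢-sym m≢s)) (lookup-toggle-same s M)

  lookup-τ-other : ∀ M {i} → i ≢ m → i ≢ s → lookup (τ M) i ≡ lookup M i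
  lookup-τ-other M i≢m i≢s = trans (lookup-toggle-other (toggle s M) i≢m) (lookup-toggle-other M i≢s)

  τ-involutive : ∀ M → τ (τ M) ≡ M
  τ-involutive M = begin
    toggle m (toggle s (toggle m (toggle s M)))  ≡⟨ cong (toggle m) (Vecₚ.updateAt-commutes s m s≢m (toggle s M)) ⟩
    toggle m (toggle m (toggle s (toggle s M)))  ≡⟨ toggle-involutive m _ ⟩
    toggle s (toggle s M)                        ≡⟨ toggle-involutive s M ⟩
    M                                            ∎
    where
    open ≡-Reasoning
    s≢m : s ≢ m
    s≢m = ≢-sym m≢s

  ∣τ∣ : ∀ M → lookup M m ≡ not (lookup M s) → ∣ τ M ∣ ≡ ∣ M ∣
  ∣τ∣ M Mm≡¬Ms with lookup M s in Ms
  ... | true  = trans (∣∣-toggle-outside m (toggle s M) [sM]m≡¬Ms) (sym (∣∣-toggle-inside s M Ms))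
    where
    [sM]m≡¬Ms : lookup (toggle s M) m ≡ false
    [sM]m≡¬Ms = trans (lookup-toggle-other M m≢s) Mm≡¬Ms
  ... | false = ℕₚ.suc-injective (trans (sym (∣∣-toggle-inside m (toggle s M) [sM]m≡¬Ms))
                                        (∣∣-toggle-outside s M Ms))
    where
    [sM]m≡¬Ms : lookup (toggle s M) m ≡ true
    [sM]m≡¬Ms = trans (lookup-toggle-other M m≢s) Mm≡¬Ms

  J∩τ : ∀ M → J ∩ τ M ≡ toggle m (J ∩ M)
  J∩τ M = lookup-ext at
    where
    at : ∀ i → lookup (J ∩ τ M) i ≡ lookup (toggle m (J ∩ M)) i
    at i with i Fin.≟ m | i Fin.≟ s
    ... | yes refl | _ rewrite lookup-∩ J (τ M) i | lookup-toggle-same i (J ∩ M) | lookup-∩ J M i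
                             | lookup-τ-m M | m∈J = refl
    ... | no i≢m | yes refl rewrite lookup-∩ J (τ M) i | lookup-toggle-other (J ∩ M) i≢m | lookup-∩ J M i
                                  | s∉J = refl
    ... | no i≢m | no i≢s rewrite lookup-∩ J (τ M) i | lookup-toggle-other (J ∩ M) i≢m | lookup-∩ J M i
                                | lookup-τ-other M i≢m i≢s = refl

  expo-τ : ∀ M → expo k J (τ M) ≡ - expo k J M
  expo-τ M with lookup (J ∩ M) m in m∈J∩M
  ... | true  = trans (sym (ℤₚ.neg-involutive _)) (cong -_ (sym (expo-suc k J M (τ M)
                  (trans (∣∣-toggle-inside m (J ∩ M) m∈J∩M) (cong (suc ∘ ∣_∣) (sym (J∩τ M)))))))
  ... | false = expo-suc k J (τ M) M (trans (cong ∣_∣ (J∩τ M)) (∣∣-toggle-outside m (J ∩ M) m∈J∩M))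

  vertex-τ : ∀ {A M} → CubeVertex J A M → CubeVertex J (toggle m A) (τ M)
  vertex-τ {A} {M} v@(vertex A⊆I eM) = vertex A′⊆I eτM
    where
    A′ : Subset n
    A′ = toggle m A
    A′⊆I : A′ ⊆I J
    A′⊆I x A′x with x Fin.≟ m
    ... | yes refl = m∈I
    ... | no x≢m   = A⊆I x (trans (sym (lookup-toggle-other A x≢m)) A′x)
    eτM : ∀ i → e (τ M) i ≡ e J i + shiftVec A′ i
    eτM i with i Fin.≟ m | i Fin.≟ s
    ... | yes refl | _ = begin
      ind (lookup (τ M) m)        ≡⟨ cong ind (trans (lookup-τ-m M) (cong not (vertex-∈ v m∈J))) ⟩
      ind (not (not (lookup A m))) ≡⟨ cong (ind ∘ not) (lookup-toggle-same m A) ⟨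
      ind (not (lookup A′ m))     ≡⟨ cube-∈ {J = J} {A′} A′⊆I m∈J ⟨
      e J m + shiftVec A′ m       ∎
      where open ≡-Reasoning
    ... | no _ | yes refl = begin
      ind (lookup (τ M) s)        ≡⟨ cong ind (trans (lookup-τ-s M) (cong not (vertex-suc v m∈I))) ⟩
      ind (not (lookup A m))      ≡⟨ cong ind (lookup-toggle-same m A) ⟨
      ind (lookup A′ m)           ≡⟨ cube-suc {J = J} {A′} A′⊆I m∈I ⟨
      e J s + shiftVec A′ s       ∎
      where open ≡-Reasoning
    ... | no i≢m | no i≢s = begin
      ind (lookup (τ M) i)        ≡⟨ cong ind (lookup-τ-other M i≢m i≢s) ⟩
      e M i                       ≡⟨ eM i ⟩
      e J i + shiftVec A i        ≡⟨ cong (e J i +_) (shiftVec-toggle A i≢m i≢s) ⟨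
      e J i + shiftVec A′ i       ∎
      where open ≡-Reasoning

  τ-∈C : ∀ {M} → T (inC k J M) → T (inC k J (τ M))
  τ-∈C {M} M∈C with to (inC⇔ {k = k} {J} {M}) M∈C
  ... | ∣M∣≡k , A , v = from (inC⇔ {k = k} {J} {τ M})
    (trans (∣τ∣ M Mm≡¬Ms) ∣M∣≡k , toggle m A , vertex-τ v)
    where
    Mm≡¬Ms : lookup M m ≡ not (lookup M s)
    Mm≡¬Ms = trans (vertex-∈ v m∈J) (cong not (sym (vertex-suc v m∈I)))

  uExp-τ : ∀ M → uExp k J (τ M) ≡ - uExp k J M
  uExp-τ M with T? (inC k J M)
  ... | yes M∈C = begin
    uExp k J (τ M)    ≡⟨ uExp-inside k J (τ M) (τ-∈C {M} M∈C) ⟩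
    expo k J (τ M)    ≡⟨ expo-τ M ⟩
    - expo k J M      ≡⟨ cong -_ (uExp-inside k J M M∈C) ⟨
    - uExp k J M      ∎
    where open ≡-Reasoning
  ... | no M∉C  = trans (uExp-outside k J (τ M) τM∉C) (cong -_ (sym (uExp-outside k J M M∉C)))
    where
    τM∉C : ¬ T (inC k J (τ M))
    τM∉C τM∈C = M∉C (subst (T ∘ inC k J) (τ-involutive M) (τ-∈C {τ M} τM∈C))

  torusWeight-away : ∀ {i} → i ≢ m → i ≢ s → torusWeight (uExp k J) i ≡ 0ℤ
  torusWeight-away {i} i≢m i≢s = i≡-i⇒i≡0 (begin
    Σℤ (subsets n) g                         ≡⟨ Σℤ-subsets-toggle m g ⟩
    Σℤ (subsets n) (g ∘ toggle m)            ≡⟨ Σℤ-subsets-toggle s (g ∘ toggle m) ⟩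
    Σℤ (subsets n) (g ∘ τ)                   ≡⟨ Σℤ-cong (subsets n) g∘τ ⟩
    Σℤ (subsets n) (-_ ∘ g)                  ≡⟨ Σℤ-neg (subsets n) g ⟩
    - Σℤ (subsets n) g                       ∎)
    where
    open ≡-Reasoning
    g : Subset n → ℤ
    g M = uExp k J M * e M i
    g∘τ : ∀ M → g (τ M) ≡ - g M
    g∘τ M = trans (cong₂ _*_ (uExp-τ M) (cong ind (lookup-τ-other M i≢m i≢s)))
                  (sym (ℤₚ.neg-distribˡ-* (uExp k J M) (e M i)))

torusWeight-unique-end : ∀ {n} k (J : Subset n) {b} → ∣ J ∣ ≡ k → lookup J b ≡ true →
                         (∀ x → x ∈I J → x ≡ b) → torusWeight (uExp k J) b ≡ - 1ℤ
torusWeight-unique-end {n} k J {b} ∣J∣≡k b∈J only-b = trans (Σℤ-subsets-single J off-J) at-J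
  where
  at-J : uExp k J J * e J b ≡ - 1ℤ
  at-J = begin
    uExp k J J * e J b                   ≡⟨ cong₂ _*_ (uExp-inside k J J (J∈C J ∣J∣≡k)) (cong ind b∈J) ⟩
    expo k J J * 1ℤ                      ≡⟨ ℤₚ.*-identityʳ _ ⟩
    sign (∣ J ∩ J ∣ ℕ.+ k ℕ.+ 1)         ≡⟨ cong (λ c → sign (∣ c ∣ ℕ.+ k ℕ.+ 1)) (∩-idem J) ⟩
    sign (∣ J ∣ ℕ.+ k ℕ.+ 1)             ≡⟨ cong (λ c → sign (c ℕ.+ k ℕ.+ 1)) ∣J∣≡k ⟩
    sign (k ℕ.+ k ℕ.+ 1)                 ≡⟨ sign-double+1 k ⟩
    - 1ℤ                                 ∎
    where open ≡-Reasoning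
  off-J : ∀ M → M ≢ J → uExp k J M * e M b ≡ 0ℤ
  off-J M M≢J with T? (inC k J M)
  ... | no M∉C rewrite uExp-outside k J M M∉C = refl
  ... | yes M∈C with to (inC⇔ {k = k} {J} {M}) M∈C
  ...   | _ , A , v with lookup A b in Ab
  ...     | true  = trans (cong (λ c → uExp k J M * ind c) (trans (vertex-∈ v b∈J) (cong not Ab)))
                          (ℤₚ.*-zeroʳ (uExp k J M))
  ...     | false = ⊥-elim (M≢J (vertex-empty v A≡∅))
    where
    A≡∅ : ∀ x → lookup A x ≡ false
    A≡∅ x with lookup A x in Ax
    ... | false = refl
    ... | true with refl ← only-b x (CubeVertex.ends v x Ax) with () ← trans (sym Ax) Ab

two-ends⇒invariant : ∀ {n} k (J : Subset n) {m₁ m₂} → m₁ ∈I J → m₂ ∈I J → m₁ ≢ m₂ →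
                     TorusInvariant (uExp k J)
two-ends⇒invariant k J {m₁} {m₂} m₁∈I@(m₁∈J , sm₁∉J) m₂∈I@(m₂∈J , sm₂∉J) m₁≢m₂ i
  with i Fin.≟ m₁ | i Fin.≟ sucMod m₁
... | no i≢m₁ | no i≢sm₁ = Flip.torusWeight-away k J m₁∈I i≢m₁ i≢sm₁
... | yes refl | _       = Flip.torusWeight-away k J m₂∈I m₁≢m₂ (∈≢∉ J m₁∈J sm₂∉J)
... | no _ | yes refl    = Flip.torusWeight-away k J m₂∈I (≢-sym (∈≢∉ J m₂∈J sm₁∉J))
                                                        (m₁≢m₂ ∘ sucMod-injective)

0<∣p∣⇒nonempty : ∀ {n} (p : Subset n) → 0 < ∣ p ∣ → Nonempty p
0<∣p∣⇒nonempty {n} p 0<∣p∣ = decidable-stable (nonempty? p) λ empty →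
  ℕₚ.<⇒≢ 0<∣p∣ (sym (trans (cong ∣_∣ (Empty-unique empty)) (∣⊥∣≡0 n)))

mainTheorem9 : (n k : ℕ) → 2 ≤ k → k < n → (J : Subset n) → ∣ J ∣ ≡ k →
    (TorusInvariant (uExp k J) → ¬ IsCyclicInterval J) × (¬ IsCyclicInterval J → TorusInvariant (uExp k J))
mainTheorem9 zero    k _   ()  J _
mainTheorem9 (suc n) k 2≤k _   J ∣J∣≡k = invariant⇒¬cyclic , ¬cyclic⇒invariant
  where
  invariant⇒¬cyclic : TorusInvariant (uExp k J) → ¬ IsCyclicInterval J
  invariant⇒¬cyclic invariant cyclic with 0<∣p∣⇒nonempty J (subst (0 <_) (sym ∣J∣≡k) (ℕₚ.<-≤-trans z<s 2≤k))
  ... | _ , j∈J with cyclic⇒unique-end cyclic j∈J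
  ... | b , b∈J , only-b with () ← trans (sym (torusWeight-unique-end k J ∣J∣≡k b∈J only-b)) (invariant b)
  ¬cyclic⇒invariant : ¬ IsCyclicInterval J → TorusInvariant (uExp k J)
  ¬cyclic⇒invariant ¬cyclic with ¬cyclic⇒two-ends J ¬cyclic
  ... | _ , _ , m₁∈I , m₂∈I , m₁≢m₂ = two-ends⇒invariant k J m₁∈I m₂∈I m₁≢m₂
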